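{- Let $r\ge 3$ and let $\mathcal{H}=(\mathcal{V},\mathcal{E})$ be an $r$-uniform bi-hypergraph. Suppose $\mathcal{V}$ has a partition $\mathcal{V}_1,\dots,\mathcal{V}_r$ such that each $\mathcal{V}_i$ ($i\in[r]$) is independent, $\mathcal{V}_r=\{w\}$ for a single vertex $w$, and for each edge $e\in\mathcal{E}$ with $w\in e$ there exists $i\in[r-1]$ with $e\cap\mathcal{V}_i=\emptyset$. Then $\mathcal{H}$ is colorable.
   Context: A bi-hypergraph is a pair $\mathcal{H}=(\mathcal{V},\mathcal{E})$ with $\mathcal{V}$ a finite set and $\mathcal{E}$ a Sperner family of subsets of $\mathcal{V}$ (edges); it is $r$-uniform if all edges have size $r$. A set $S\subseteq\mathcal{V}$ is independent if no edge is contained in $S$. A proper coloring is a map $f:\mathcal{V}\to\mathbb{N}$ with $1<|\{f(v):v\in e\}|<|e|$ for every edge $e$; $\mathcal{H}$ is colorable if such $f$ exists. $[k]=\{1,\dots,k\}$. -}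

module Defs where

open import Data.Nat using (ℕ; _<_; _≤_; _≟_)
open import Data.Fin using (Fin)
open import Data.Fin.Subset using (Subset; _⊆_; _∈_; _∩_; ∣_∣; Empty; Nonempty; ⁅_⁆)
open import Data.Fin.Subset.Properties using (_∈?_)
open import Data.List using (List; filter; map; length; deduplicate; allFin)
open import Data.List.Membership.Propositional renaming (_∈_ to _∈ₗ_)
open import Data.Product using (_×_; ∃)
open import Relation.Binary.PropositionalEquality using (_≡_; _≢_)
open import Relation.Nullary using (¬_)

record BiHypergraph (n : ℕ) : Set where
  field
    edges : List (Subset n)
    sperner : ∀ {e e′} → e ∈ₗ edges → e′ ∈ₗ edges → e ⊆ e′ → e ≡ e′
open BiHypergraph public

Uniform : ∀ {n} → ℕ → BiHypergraph n → Set
Uniform r H = ∀ {e} → e ∈ₗ edges H → ∣ e ∣ ≡ r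

Independent : ∀ {n} → BiHypergraph n → Subset n → Set
Independent H S = ∀ {e} → e ∈ₗ edges H → ¬ (e ⊆ S)

members : ∀ {n} → Subset n → List (Fin n)
members e = filter (_∈? e) (allFin _)

numColors : ∀ {n} → (Fin n → ℕ) → Subset n → ℕ
numColors f e = length (deduplicate _≟_ (map f (members e)))

ProperColoring : ∀ {n} → BiHypergraph n → (Fin n → ℕ) → Set
ProperColoring H f = ∀ {e} → e ∈ₗ edges H → (1 < numColors f e) × (numColors f e < ∣ e ∣)

Colorable : ∀ {n} → BiHypergraph n → Set
Colorable H = ∃ λ (f : Fin _ → ℕ) → ProperColoring H f

IsPartition : ∀ {n} → ℕ → (ℕ → Subset n) → Set
IsPartition {n} r V =
  (∀ i → 1 ≤ i → i ≤ r → Nonempty (V i)) ×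
  (∀ i j → 1 ≤ i → i ≤ r → 1 ≤ j → j ≤ r → i ≢ j → Empty (V i ∩ V j)) ×
  (∀ (v : Fin n) → ∃ λ i → 1 ≤ i × i ≤ r × v ∈ V i)

-- Colour every vertex by the index of its block. An edge is never inside one
-- block (blocks are independent), so it sees at least two colours; and every
-- edge misses some block (the hypothesis when it contains w, the block {w}
-- otherwise), so it sees at most r − 1 < |e| colours.
module Submission where

open import Defs
open import Data.Nat using (ℕ; suc; _+_; _≤_; _<_; _∸_; z≤n; s≤s) renaming (_≟_ to _≟ℕ_)
open import Data.Nat.Properties using (≤-refl; ≤-trans; ≤-reflexive; +-suc; m∸n≤m)
open import Data.Fin using (Fin)
open import Data.Fin.Subset using (Subset; _∈_; _∉_; _∩_; _⊈_; Empty; ⁅_⁆)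
open import Data.Fin.Subset.Properties using (_∈?_; x∈p∩q⁺; x∈p∩q⁻; x∈⁅y⁆⇒x≡y)
open import Data.Fin.Properties using (¬∀⟶∃¬)
open import Data.List using (List; []; _∷_; _++_; length; map; deduplicate; applyUpTo; allFin)
open import Data.List.Properties using (length-++; length-applyUpTo)
open import Data.List.Membership.Propositional using () renaming (_∈_ to _∈ₗ_)
open import Data.List.Membership.Propositional.Properties
  using (∈-∃++; ∈-++⁺ˡ; ∈-++⁺ʳ; ∈-++⁻; ∈-map⁺; ∈-map⁻; ∈-filter⁺; ∈-filter⁻; ∈-allFin;
         ∈-deduplicate⁺; ∈-deduplicate⁻; ∈-applyUpTo⁺)
open import Data.List.Relation.Unary.Any using (here; there)
open import Data.List.Relation.Unary.All as All using (All)
open import Data.List.Relation.Unary.AllPairs using (_∷_)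
open import Data.List.Relation.Unary.Unique.Propositional using (Unique)
open import Data.List.Relation.Unary.Unique.DecPropositional.Properties using (deduplicate-!)
open import Data.Product using (_×_; ∃; _,_; proj₁; proj₂)
open import Data.Sum using (inj₁; inj₂)
open import Relation.Binary.PropositionalEquality
  using (_≡_; _≢_; refl; sym; cong; subst; module ≡-Reasoning)
open import Relation.Nullary using (yes; no; contradiction)
open import Relation.Nullary.Decidable using (_→-dec_)

module _ {a} {A : Set a} where

  length-++-∷ : (xs ys : List A) {y : A} → length (xs ++ y ∷ ys) ≡ suc (length (xs ++ ys))
  length-++-∷ xs ys {y} = begin
    length (xs ++ y ∷ ys)          ≡⟨ length-++ xs ⟩
    length xs + suc (length ys)    ≡⟨ +-suc (length xs) (length ys) ⟩
    suc (length xs + length ys)    ≡⟨ cong suc (sym (length-++ xs)) ⟩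
    suc (length (xs ++ ys))        ∎
    where open ≡-Reasoning

  Unique-⊆⇒length≤ : {xs ys : List A} → Unique xs → (∀ {x} → x ∈ₗ xs → x ∈ₗ ys) →
                     length xs ≤ length ys
  Unique-⊆⇒length≤ {[]} _ _ = z≤n
  Unique-⊆⇒length≤ {x ∷ xs} (x∉xs ∷ uniq) xs⊆ys with ∈-∃++ (xs⊆ys (here refl))
  ... | ys₁ , ys₂ , refl =
    ≤-trans (s≤s (Unique-⊆⇒length≤ uniq xs⊆ys₁++ys₂)) (≤-reflexive (sym (length-++-∷ ys₁ ys₂)))
    where
    xs⊆ys₁++ys₂ : ∀ {z} → z ∈ₗ xs → z ∈ₗ ys₁ ++ ys₂
    xs⊆ys₁++ys₂ z∈xs with ∈-++⁻ ys₁ (xs⊆ys (there z∈xs))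
    ... | inj₁ z∈ys₁         = ∈-++⁺ˡ z∈ys₁
    ... | inj₂ (here refl)   = contradiction refl (All.lookup x∉xs z∈xs)
    ... | inj₂ (there z∈ys₂) = ∈-++⁺ʳ ys₁ z∈ys₂

  1<length : {xs : List A} {x y : A} → x ∈ₗ xs → y ∈ₗ xs → x ≢ y → 1 < length xs
  1<length {_ ∷ _ ∷ _} _           _           _   = s≤s (s≤s z≤n)
  1<length {_ ∷ []}    (here refl) (here refl) x≢y = contradiction refl x≢y

⊈⇒∃∈∉ : ∀ {n} {p q : Subset n} → p ⊈ q → ∃ λ x → x ∈ p × x ∉ q
⊈⇒∃∈∉ {n} {p} {q} p⊈q with ¬∀⟶∃¬ n (λ x → x ∈ p → x ∈ q) (λ x → (x ∈? p) →-dec (x ∈? q)) (λ p⊆q → p⊈q (p⊆q _))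
... | x , x∈p⇏x∈q with x ∈? p
...   | yes x∈p = x , x∈p , λ x∈q → x∈p⇏x∈q (λ _ → x∈q)
...   | no  x∉p = contradiction (λ x∈p → contradiction x∈p x∉p) x∈p⇏x∈q

∉⇒Empty-∩⁅⁆ : ∀ {n} {p : Subset n} {w : Fin n} → w ∉ p → Empty (p ∩ ⁅ w ⁆)
∉⇒Empty-∩⁅⁆ {p = p} {w} w∉p (x , x∈p∩⁅w⁆) with x∈p∩q⁻ p ⁅ w ⁆ x∈p∩⁅w⁆
... | x∈p , x∈⁅w⁆ = w∉p (subst (_∈ p) (x∈⁅y⁆⇒x≡y w x∈⁅w⁆) x∈p)

module _ {n : ℕ} (f : Fin n → ℕ) where

  colours : Subset n → List ℕ
  colours e = deduplicate _≟ℕ_ (map f (members e))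

  ∈-colours⁺ : ∀ {e v} → v ∈ e → f v ∈ₗ colours e
  ∈-colours⁺ {e} v∈e = ∈-deduplicate⁺ _≟ℕ_ (∈-map⁺ f (∈-filter⁺ (_∈? e) (∈-allFin _) v∈e))

  ∈-colours⁻ : ∀ {e c} → c ∈ₗ colours e → ∃ λ v → v ∈ e × c ≡ f v
  ∈-colours⁻ {e} c∈ with ∈-map⁻ f (∈-deduplicate⁻ _≟ℕ_ (map f (members e)) c∈)
  ... | v , v∈members , c≡fv = v , proj₂ (∈-filter⁻ (_∈? e) {xs = allFin n} v∈members) , c≡fv

  1<numColors : ∀ {e u v} → u ∈ e → v ∈ e → f u ≢ f v → 1 < numColors f e
  1<numColors u∈e v∈e = 1<length (∈-colours⁺ u∈e) (∈-colours⁺ v∈e)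

  -- The colours of e together with the unused j are distinct elements of 1 … r.
  numColors< : ∀ {e r j} → (∀ {v} → v ∈ e → 1 ≤ f v × f v ≤ r) →
               1 ≤ j → j ≤ r → (∀ {v} → v ∈ e → f v ≢ j) → numColors f e < r
  numColors< {e} {r} {j} range 1≤j j≤r unused =
    ≤-trans (Unique-⊆⇒length≤ (j∉colours ∷ deduplicate-! _≟ℕ_ (map f (members e))) ⊆1…r)
            (≤-reflexive (length-applyUpTo suc r))
    where
    j∉colours : All (j ≢_) (colours e)
    j∉colours = All.tabulate λ c∈ j≡c → case (∈-colours⁻ c∈) j≡c
      where
      case : ∀ {c} → (∃ λ v → v ∈ e × c ≡ f v) → j ≢ c
      case (v , v∈e , refl) j≡fv = unused v∈e (sym j≡fv)
    ∈1…r : ∀ {i} → 1 ≤ i → i ≤ r → i ∈ₗ applyUpTo suc r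
    ∈1…r {suc i} _ i<r = ∈-applyUpTo⁺ suc i<r
    ⊆1…r : ∀ {c} → c ∈ₗ j ∷ colours e → c ∈ₗ applyUpTo suc r
    ⊆1…r (here refl) = ∈1…r 1≤j j≤r
    ⊆1…r (there c∈) with ∈-colours⁻ c∈
    ... | v , v∈e , refl = ∈1…r (proj₁ (range v∈e)) (proj₂ (range v∈e))

module BlockColouring {n r : ℕ} (V : ℕ → Subset n)
                      (cover : ∀ (v : Fin n) → ∃ λ i → 1 ≤ i × i ≤ r × v ∈ V i) where

  block : Fin n → ℕ
  block v = proj₁ (cover v)

  block-range : ∀ v → 1 ≤ block v × block v ≤ r
  block-range v = proj₁ (proj₂ (cover v)) , proj₁ (proj₂ (proj₂ (cover v)))

  ∈-block : ∀ v → v ∈ V (block v)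
  ∈-block v = proj₂ (proj₂ (proj₂ (cover v)))

  -- Leaving V 1 gives a vertex u of e, and leaving V (block u) a second colour.
  1<numColors-block : ∀ {e} → 1 ≤ r → (∀ i → 1 ≤ i → i ≤ r → e ⊈ V i) → 1 < numColors block e
  1<numColors-block 1≤r e⊈V with ⊈⇒∃∈∉ (e⊈V 1 ≤-refl 1≤r)
  ... | u , u∈e , _ with ⊈⇒∃∈∉ (e⊈V (block u) (proj₁ (block-range u)) (proj₂ (block-range u)))
  ...   | v , v∈e , v∉Vu =
    1<numColors block v∈e u∈e λ bv≡bu → v∉Vu (subst (λ i → v ∈ V i) bv≡bu (∈-block v))

  numColors-block< : ∀ {e j} → 1 ≤ j → j ≤ r → Empty (e ∩ V j) → numColors block e < r
  numColors-block< 1≤j j≤r e∩Vj-empty =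
    numColors< block (λ {v} _ → block-range v) 1≤j j≤r
      λ {v} v∈e bv≡j → e∩Vj-empty (v , x∈p∩q⁺ (v∈e , subst (λ i → v ∈ V i) bv≡j (∈-block v)))

corollary2p3 : (r : ℕ) → 3 ≤ r → {n : ℕ} → (H : BiHypergraph n) → Uniform r H →
    (V : ℕ → Subset n) → IsPartition r V →
    (∀ i → 1 ≤ i → i ≤ r → Independent H (V i)) →
    (w : Fin n) → V r ≡ ⁅ w ⁆ →
    (∀ {e} → e ∈ₗ edges H → w ∈ e → ∃ λ i → 1 ≤ i × i ≤ r ∸ 1 × Empty (e ∩ V i)) →
    Colorable H
corollary2p3 r 3≤r H uniform V (_ , _ , cover) independent w Vr≡⁅w⁆ w-edges-miss = block , proper
  where
  open BlockColouring V cover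

  1≤r : 1 ≤ r
  1≤r = ≤-trans (s≤s z≤n) 3≤r

  misses-block : ∀ {e} → e ∈ₗ edges H → ∃ λ j → 1 ≤ j × j ≤ r × Empty (e ∩ V j)
  misses-block {e} e∈H with w ∈? e
  ... | yes w∈e = let j , 1≤j , j≤r∸1 , empty = w-edges-miss e∈H w∈e
                  in j , 1≤j , ≤-trans j≤r∸1 (m∸n≤m r 1) , empty
  ... | no  w∉e = r , 1≤r , ≤-refl , subst (λ S → Empty (e ∩ S)) (sym Vr≡⁅w⁆) (∉⇒Empty-∩⁅⁆ w∉e)

  proper : ProperColoring H block
  proper {e} e∈H with misses-block e∈H
  ... | j , 1≤j , j≤r , empty =
    1<numColors-block 1≤r (λ i 1≤i i≤r → independent i 1≤i i≤r e∈H) ,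
    subst (numColors block e <_) (sym (uniform e∈H)) (numColors-block< 1≤j j≤r empty)
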